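{- Let $G=(V,E)$ be a 3-vertex-connected graph with minimum degree $\delta$. Then Broadcast on $G$ is unsolvable with $k$ ignorant agents whenever $k\le \delta-2$.
   Context: A graph is 3-vertex-connected if it has more than 3 vertices and remains connected after deleting any 2 vertices. The Broadcast problem: a connected base graph $G=(V,E)$ is given and time proceeds in synchronous rounds. In each round the adversary first removes a (possibly empty) set $E'\subseteq E$ such that $(V,E\setminus E')$ is connected; then each agent, after local computation and communication with agents at the same node, either stays or moves along one edge of $E\setminus E'$ incident to its node; all agents move simultaneously. Agents have unique IDs, local memory, and full knowledge at every round of $G$, the current edge set, and the positions and knowledge status of all agents. Initially one source agent holding a message $\mathcal M$ and $k\ge 1$ ignorant agents are placed at distinct nodes, the placement chosen by the adversary. An ignorant agent becomes a source agent when at the same node as a source agent. Broadcast is solvable on $G$ with $k$ ignorant agents if the agents have a strategy that, for every initial placement and every adversary behavior, makes all agents source agents within finitely many rounds; otherwise it is unsolvable (the adversary has a winning strategy). -}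

module Defs where

open import Data.Nat using (ℕ; zero; suc; _<_; _≤_; _+_)
open import Data.Fin using (Fin; zero; suc; _≟_)
open import Data.Bool using (Bool; true; false; _∧_; _∨_; if_then_else_)
open import Data.List using (List; []; _∷_; map; allFin)
open import Data.Nat.ListAction using (sum)
open import Data.Bool.ListAction using (any)
open import Data.Product using (Σ; ∃; _×_; _,_; proj₁; proj₂)
open import Data.Sum using (_⊎_)
open import Relation.Binary.PropositionalEquality using (_≡_; _≢_)
open import Relation.Binary.Construct.Closure.ReflexiveTransitive using (Star)
open import Relation.Nullary.Decidable using (⌊_⌋)

record Graph : Set where
  field
    n      : ℕ
    adj    : Fin n → Fin n → Bool
    sym    : ∀ u v → adj u v ≡ adj v u
    irrefl : ∀ v → adj v v ≡ false

open Graph public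

Vertex : Graph → Set
Vertex G = Fin (n G)

degree : (G : Graph) → Vertex G → ℕ
degree G u = sum (map (λ v → if adj G u v then 1 else 0) (allFin (n G)))

IsMinDegree : Graph → ℕ → Set
IsMinDegree G δ = (∀ v → δ ≤ degree G v) × (∃ λ v → degree G v ≡ δ)

Connected : (m : ℕ) → (Fin m → Fin m → Bool) → Set
Connected m E = ∀ u v → Star (λ x y → E x y ≡ true) u v

ThreeVertexConnected : Graph → Set
ThreeVertexConnected G =
  3 < n G ×
  (∀ (a b : Vertex G) → a ≢ b →
     ∀ (u v : Vertex G) → u ≢ a → u ≢ b → v ≢ a → v ≢ b →
     Star (λ x y → (adj G x y ≡ true) × x ≢ a × x ≢ b × y ≢ a × y ≢ b) u v)

-- The Broadcast game on G with k ignorant agents.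
-- Agents are Fin (suc k); agent zero is the initial source agent.

EdgeSet : Graph → Set
EdgeSet G = Vertex G → Vertex G → Bool

ValidEdgeSet : (G : Graph) → EdgeSet G → Set
ValidEdgeSet G F =
  (∀ u v → F u v ≡ true → adj G u v ≡ true) ×
  (∀ u v → F u v ≡ F v u) ×
  Connected (n G) F

Agent : ℕ → Set
Agent k = Fin (suc k)

record Config (G : Graph) (k : ℕ) : Set where
  constructor config
  field
    pos      : Agent k → Vertex G
    informed : Agent k → Bool   -- true = source agent, false = ignorant

open Config public

-- history of the game so far: previous configurations together with the
-- edge set present in that round (most recent first)
History : Graph → ℕ → Set
History G k = List (Config G k × EdgeSet G)

-- A (deterministic) joint strategy of the agents: since every agent knows
-- G, the current edge set, and all positions and knowledge statuses at every
-- round (and can remember them), a decision may depend on the whole history,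
-- the current configuration and the current edge set.
AgentStrategy : Graph → ℕ → Set
AgentStrategy G k = History G k → Config G k → EdgeSet G → Agent k → Vertex G

LegalMove : (G : Graph) → EdgeSet G → Vertex G → Vertex G → Set
LegalMove G F u w = (w ≡ u) ⊎ (F u w ≡ true)

LegalStrategy : (G : Graph) (k : ℕ) → AgentStrategy G k → Set
LegalStrategy G k σ =
  ∀ h c F a → LegalMove G F (pos c a) (σ h c F a)

record Adversary (G : Graph) (k : ℕ) : Set where
  field
    choose : History G k → Config G k → EdgeSet G
    valid  : ∀ h c → ValidEdgeSet G (choose h c)

open Adversary public

initInformed : (k : ℕ) → Agent k → Bool
initInformed k zero    = true
initInformed k (suc _) = false

initialConfig : (G : Graph) (k : ℕ) → (Agent k → Vertex G) → Config G k
initialConfig G k p = config p (initInformed k)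

updateInformed : (G : Graph) (k : ℕ) → (Agent k → Vertex G) → (Agent k → Bool)
               → Agent k → Bool
updateInformed G k p inf a =
  inf a ∨ any (λ b → inf b ∧ ⌊ p b ≟ p a ⌋) (allFin (suc k))

run : (G : Graph) (k : ℕ) → AgentStrategy G k → Adversary G k → Config G k
    → ℕ → History G k × Config G k
run G k σ A c₀ zero = ([] , c₀)
run G k σ A c₀ (suc t) with run G k σ A c₀ t
... | (h , c) =
  let F  = choose A h c
      p′ = σ h c F
  in ((c , F) ∷ h , config p′ (updateInformed G k p′ (informed c)))

AllInformed : (G : Graph) (k : ℕ) → Config G k → Set
AllInformed G k c = ∀ a → informed c a ≡ true

BroadcastSolvable : Graph → ℕ → Set
BroadcastSolvable G k =
  Σ (AgentStrategy G k) λ σ →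
    LegalStrategy G k σ ×
    (∀ (p : Agent k → Vertex G) → (∀ a b → p a ≡ p b → a ≡ b) →
     ∀ (A : Adversary G k) →
     ∃ λ t → AllInformed G k (proj₂ (run G k σ A (initialConfig G k p) t)))

{-# OPTIONS --safe #-}
module Submission where

open import Defs hiding (sym)
open import Data.Nat using (ℕ; _≤_; _∸_; zero; suc; _<_; z≤n; s≤s; s≤s⁻¹)
open import Data.Nat.Properties using (≤-trans; <-≤-trans; ≤-<-trans; n≤1+n; m≤n⇒m≤1+n)
open import Data.Fin using (Fin; zero; suc; inject≤; fromℕ<; _≟_)
open import Data.Fin.Properties using (inject≤-injective; 0≢1+n)
open import Data.Bool using (Bool; true; false; _∧_; _∨_; if_then_else_)
open import Data.Bool.Properties using (∨-zeroʳ; ∧-comm; not-¬)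
open import Data.List using (List; []; _∷_; tabulate; length; allFin)
open import Data.List.Properties using (map-tabulate; length-tabulate)
open import Data.Nat.ListAction using (sum)
open import Data.Bool.ListAction using (any)
open import Data.List.Membership.Propositional using (_∈_; _∉_)
open import Data.List.Membership.Propositional.Properties using (∈-tabulate⁺)
open import Data.List.Relation.Unary.Any using (here; there; any?)
open import Data.Product using (∃; _×_; _,_; proj₁; proj₂)
open import Data.Sum using (_⊎_; inj₁; inj₂)
open import Function using (_∘_; id)
open import Relation.Nullary using (¬_; yes; no; does; contradiction)
open import Relation.Nullary.Decidable using (⌊_⌋; dec-true; dec-false)
open import Relation.Binary.PropositionalEquality using (_≡_; _≢_; refl; sym; trans; cong; subst; subst₂)
open import Relation.Binary.Construct.Closure.ReflexiveTransitive using (Star; ε; _◅_; _◅◅_; gmap; reverse)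

-- The adversary traps the source.  If the source is at s, pick a neighbour w of s and a
-- neighbour x of w, both unoccupied: every vertex has at least k + 2 neighbours and only k + 1
-- nodes are occupied.  In this round keep, at s, only the edge sw and, at w, only ws and wx.
-- The graph stays connected, since G - {s, w} is connected and x attaches it to the path s w.
-- The source can only stay at s or move to w, whereas an ignorant agent, being outside
-- {s, w, x}, can reach neither s nor w; so no ignorant agent ever meets the source.

count : ∀ {m} → (Fin m → Bool) → ℕ
count f = sum (tabulate (λ v → if f v then 1 else 0))

count≤ : ∀ {m} (f : Fin m → Bool) → count f ≤ m
count≤ {zero}  f = z≤n
count≤ {suc m} f with f zero
... | true  = s≤s (count≤ (f ∘ suc))
... | false = m≤n⇒m≤1+n (count≤ (f ∘ suc))

unsucs : ∀ {m} → List (Fin (suc m)) → List (Fin m)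
unsucs []          = []
unsucs (zero  ∷ L) = unsucs L
unsucs (suc i ∷ L) = i ∷ unsucs L

length-unsucs : ∀ {m} (L : List (Fin (suc m))) → length (unsucs L) ≤ length L
length-unsucs []          = z≤n
length-unsucs (zero  ∷ L) = m≤n⇒m≤1+n (length-unsucs L)
length-unsucs (suc i ∷ L) = s≤s (length-unsucs L)

length-unsucs-< : ∀ {m} (L : List (Fin (suc m))) → zero ∈ L → length (unsucs L) < length L
length-unsucs-< (zero  ∷ L) _           = s≤s (length-unsucs L)
length-unsucs-< (suc i ∷ L) (there z∈L) = s≤s (length-unsucs-< L z∈L)

∈-unsucs : ∀ {m} {i : Fin m} (L : List (Fin (suc m))) → suc i ∈ L → i ∈ unsucs L
∈-unsucs (zero  ∷ L) (there i∈L) = ∈-unsucs L i∈L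
∈-unsucs (suc j ∷ L) (here refl) = here refl
∈-unsucs (suc j ∷ L) (there i∈L) = there (∈-unsucs L i∈L)

∃∉-suc : ∀ {m} {f : Fin (suc m) → Bool} (L : List (Fin (suc m))) →
         (∃ λ i → f (suc i) ≡ true × i ∉ unsucs L) → ∃ λ v → f v ≡ true × v ∉ L
∃∉-suc L (i , fi , i∉) = suc i , fi , i∉ ∘ ∈-unsucs L

length<count⇒∃∉ : ∀ {m} (f : Fin m → Bool) (L : List (Fin m)) → length L < count f →
                  ∃ λ v → f v ≡ true × v ∉ L
length<count⇒∃∉ {zero}  f L ()
length<count⇒∃∉ {suc m} f L |L|<f with f zero in f0 | any? (zero ≟_) L
... | true  | no  0∉L = zero , f0 , 0∉L
... | true  | yes 0∈L = ∃∉-suc L (length<count⇒∃∉ (f ∘ suc) (unsucs L)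
                           (<-≤-trans (length-unsucs-< L 0∈L) (s≤s⁻¹ |L|<f)))
... | false | _       = ∃∉-suc L (length<count⇒∃∉ (f ∘ suc) (unsucs L)
                           (≤-<-trans (length-unsucs L) |L|<f))

degree≡count : (G : Graph) (u : Vertex G) → degree G u ≡ count (adj G u)
degree≡count G u = cong sum (map-tabulate id (λ v → if adj G u v then 1 else 0))

degree≤n : (G : Graph) (u : Vertex G) → degree G u ≤ n G
degree≤n G u = subst (_≤ n G) (sym (degree≡count G u)) (count≤ (adj G u))

adj⇒≢ : (G : Graph) {u v : Vertex G} → adj G u v ≡ true → v ≢ u
adj⇒≢ G {u} uv refl with () ← trans (sym uv) (irrefl G u)

≟-true⇒≡ : ∀ {m} {u v : Fin m} → does (u ≟ v) ≡ true → u ≡ v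
≟-true⇒≡ {u = u} {v} eq with u ≟ v | eq
... | yes u≡v | _ = u≡v

module Trap (G : Graph) (s w x : Vertex G) where

  permits : Vertex G → Vertex G → Bool
  permits u v = if does (u ≟ s) then does (v ≟ w)
                else if does (u ≟ w) then does (v ≟ s) ∨ does (v ≟ x)
                else true

  trapEdges : EdgeSet G
  trapEdges u v = adj G u v ∧ (permits u v ∧ permits v u)

  trapEdges-intro : ∀ {u v} → adj G u v ≡ true → permits u v ≡ true → permits v u ≡ true →
                    trapEdges u v ≡ true
  trapEdges-intro uv puv pvu rewrite uv | puv | pvu = refl

  trapEdges⊆adj : ∀ u v → trapEdges u v ≡ true → adj G u v ≡ true
  trapEdges⊆adj u v e with true ← adj G u v = refl

  trapEdges⇒permits : ∀ {u v} → trapEdges u v ≡ true → permits u v ≡ true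
  trapEdges⇒permits {u} {v} e with true ← adj G u v | true ← permits u v = refl

  trapEdges-sym : ∀ u v → trapEdges u v ≡ trapEdges v u
  trapEdges-sym u v rewrite Graph.sym G u v | ∧-comm (permits u v) (permits v u) = refl

  trapEdges⇒permitsʳ : ∀ {u v} → trapEdges u v ≡ true → permits v u ≡ true
  trapEdges⇒permitsʳ {u} {v} e = trapEdges⇒permits (trans (trapEdges-sym v u) e)

  permits-from-s : ∀ {v} → permits s v ≡ true → v ≡ w
  permits-from-s e rewrite dec-true (s ≟ s) refl = ≟-true⇒≡ e

  permits-from-w : w ≢ s → ∀ {v} → permits w v ≡ true → v ≡ s ⊎ v ≡ x
  permits-from-w w≢s {v} e rewrite dec-false (w ≟ s) w≢s | dec-true (w ≟ w) refl
    with v ≟ s | v ≟ x | e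
  ... | yes v≡s | _       | _ = inj₁ v≡s
  ... | no _    | yes v≡x | _ = inj₂ v≡x

  permits-elsewhere : ∀ {u} v → u ≢ s → u ≢ w → permits u v ≡ true
  permits-elsewhere {u} v u≢s u≢w rewrite dec-false (u ≟ s) u≢s | dec-false (u ≟ w) u≢w = refl

  permits-sw : permits s w ≡ true
  permits-sw rewrite dec-true (s ≟ s) refl | dec-true (w ≟ w) refl = refl

  permits-ws : w ≢ s → permits w s ≡ true
  permits-ws w≢s
    rewrite dec-false (w ≟ s) w≢s | dec-true (w ≟ w) refl | dec-true (s ≟ s) refl = refl

  permits-wx : w ≢ s → permits w x ≡ true
  permits-wx w≢s
    rewrite dec-false (w ≟ s) w≢s | dec-true (w ≟ w) refl | dec-true (x ≟ x) refl =
    ∨-zeroʳ (does (x ≟ s))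

  module _ (w≢s : w ≢ s) where

    trapEdges-connected : ThreeVertexConnected G → adj G s w ≡ true → adj G w x ≡ true →
                          x ≢ s → x ≢ w → Connected (n G) trapEdges
    trapEdges-connected (_ , 3conn) sw wx x≢s x≢w u v =
      toX u ◅◅ reverse (λ {a} {b} e → trans (trapEdges-sym b a) e) (toX v)
      where
      Edge : Vertex G → Vertex G → Set
      Edge a b = trapEdges a b ≡ true

      w→x : Edge w x
      w→x = trapEdges-intro wx (permits-wx w≢s) (permits-elsewhere w x≢s x≢w)

      toX : ∀ u → Star Edge u x
      toX u with u ≟ s | u ≟ w
      ... | yes refl | _        = trapEdges-intro sw permits-sw (permits-ws w≢s) ◅ w→x ◅ ε
      ... | no _     | yes refl = w→x ◅ ε
      ... | no u≢s   | no u≢w   =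
        gmap id (λ { {a} {b} (ab , a≢s , a≢w , b≢s , b≢w) →
                       trapEdges-intro ab (permits-elsewhere b a≢s a≢w) (permits-elsewhere a b≢s b≢w) })
             (3conn s w (w≢s ∘ sym) u x u≢s u≢w x≢s x≢w)

    trapEdges-valid : ThreeVertexConnected G → adj G s w ≡ true → adj G w x ≡ true →
                      x ≢ s → x ≢ w → ValidEdgeSet G trapEdges
    trapEdges-valid 3conn sw wx x≢s x≢w =
      trapEdges⊆adj , trapEdges-sym , trapEdges-connected 3conn sw wx x≢s x≢w

    move-from-s : ∀ {v} → LegalMove G trapEdges s v → v ≡ s ⊎ v ≡ w
    move-from-s (inj₁ v≡s) = inj₁ v≡s
    move-from-s (inj₂ sv)  = inj₂ (permits-from-s (trapEdges⇒permits sv))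

    move-outside-trap : ∀ {y v} → y ≢ s → y ≢ w → y ≢ x → LegalMove G trapEdges y v →
                        v ≢ s × v ≢ w
    move-outside-trap {y} y≢s y≢w y≢x move = avoid-s move , avoid-w move
      where
      avoid-s : ∀ {v} → LegalMove G trapEdges y v → v ≢ s
      avoid-s (inj₁ refl) refl = y≢s refl
      avoid-s (inj₂ ys)   refl = y≢w (permits-from-s (trapEdges⇒permitsʳ ys))

      avoid-w : ∀ {v} → LegalMove G trapEdges y v → v ≢ w
      avoid-w (inj₁ refl) refl = y≢w refl
      avoid-w (inj₂ yw)   refl with permits-from-w w≢s (trapEdges⇒permitsʳ yw)
      ... | inj₁ y≡s = y≢s y≡s
      ... | inj₂ y≡x = y≢x y≡x

any-false : ∀ {A : Set} {p : A → Bool} → (∀ a → p a ≡ false) → ∀ xs → any p xs ≡ false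
any-false p≡false []       = refl
any-false p≡false (a ∷ xs) rewrite p≡false a = any-false p≡false xs

updateInformed-ignorant : (G : Graph) (k : ℕ) (p : Agent k → Vertex G) (inf : Agent k → Bool)
                          (a : Agent k) → inf a ≡ false → (∀ b → inf b ≡ true → p b ≢ p a) →
                          updateInformed G k p inf a ≡ false
updateInformed-ignorant G k p inf a ignorant apart rewrite ignorant =
  any-false met-nobody (allFin (suc k))
  where
  met-nobody : ∀ b → (inf b ∧ ⌊ p b ≟ p a ⌋) ≡ false
  met-nobody b with inf b in informed | p b ≟ p a
  ... | true  | yes met = contradiction met (apart b informed)
  ... | true  | no _    = refl
  ... | false | _       = refl

module TrapAdversary (G : Graph) (3conn : ThreeVertexConnected G) (k : ℕ)
                     (large-degree : ∀ u → suc (suc k) ≤ degree G u) where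

  occupied : Config G k → List (Vertex G)
  occupied c = tabulate (pos c)

  free-neighbour : (c : Config G k) (u : Vertex G) → ∃ λ v → adj G u v ≡ true × v ∉ occupied c
  free-neighbour c u = length<count⇒∃∉ (adj G u) (occupied c)
    (subst₂ _≤_ (cong suc (sym (length-tabulate (pos c)))) (degree≡count G u) (large-degree u))

  free-neighbour-unoccupied : ∀ c u a → pos c a ≢ proj₁ (free-neighbour c u)
  free-neighbour-unoccupied c u a eq =
    proj₂ (proj₂ (free-neighbour c u)) (subst (_∈ occupied c) eq (∈-tabulate⁺ {f = pos c} a))

  module Round (c : Config G k) where
    s w x : Vertex G
    s = pos c zero
    w = proj₁ (free-neighbour c s)
    x = proj₁ (free-neighbour c w)

    s-w : adj G s w ≡ true
    s-w = proj₁ (proj₂ (free-neighbour c s))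

    w-x : adj G w x ≡ true
    w-x = proj₁ (proj₂ (free-neighbour c w))

    unoccupied-w : ∀ a → pos c a ≢ w
    unoccupied-w = free-neighbour-unoccupied c s

    unoccupied-x : ∀ a → pos c a ≢ x
    unoccupied-x = free-neighbour-unoccupied c w

    w≢s : w ≢ s
    w≢s = unoccupied-w zero ∘ sym

    open Trap G s w x public

  trapAdversary : Adversary G k
  trapAdversary = record
    { choose = λ _ c → Round.trapEdges c
    ; valid  = λ _ c → let open Round c in
        trapEdges-valid w≢s 3conn s-w w-x (unoccupied-x zero ∘ sym) (adj⇒≢ G w-x)
    }

  SourceIsolated : Config G k → Set
  SourceIsolated c = ∀ i → informed c (suc i) ≡ false × pos c (suc i) ≢ pos c zero

  round-keeps-isolated : ∀ c (p′ : Agent k → Vertex G) →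
                         (∀ a → LegalMove G (Round.trapEdges c) (pos c a) (p′ a)) →
                         SourceIsolated c →
                         SourceIsolated (config p′ (updateInformed G k p′ (informed c)))
  round-keeps-isolated c p′ legal isolated i =
    updateInformed-ignorant G k p′ (informed c) (suc i) (proj₁ (isolated i)) met-only-source , apart
    where
    open Round c

    apart : p′ (suc i) ≢ p′ zero
    apart with move-outside-trap w≢s (proj₂ (isolated i)) (unoccupied-w (suc i))
                 (unoccupied-x (suc i)) (legal (suc i))
             | move-from-s w≢s (legal zero)
    ... | ≢s , _  | inj₁ ≡s = λ e → ≢s (trans e ≡s)
    ... | _  , ≢w | inj₂ ≡w = λ e → ≢w (trans e ≡w)

    met-only-source : ∀ b → informed c b ≡ true → p′ b ≢ p′ (suc i)
    met-only-source zero    _        = apart ∘ sym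
    met-only-source (suc j) informed = contradiction informed (not-¬ (proj₁ (isolated j)))

  isolated-forever : (σ : AgentStrategy G k) → LegalStrategy G k σ → ∀ c₀ → SourceIsolated c₀ →
                     ∀ t → SourceIsolated (proj₂ (run G k σ trapAdversary c₀ t))
  isolated-forever σ legal c₀ isolated₀ zero = isolated₀
  isolated-forever σ legal c₀ isolated₀ (suc t)
    with run G k σ trapAdversary c₀ t | isolated-forever σ legal c₀ isolated₀ t
  ... | h , c | isolated = round-keeps-isolated c _ (legal h c _) isolated

  never-all-informed : (σ : AgentStrategy G k) → LegalStrategy G k σ → ∀ c₀ → SourceIsolated c₀ →
                       Fin k → ∀ t → ¬ AllInformed G k (proj₂ (run G k σ trapAdversary c₀ t))
  never-all-informed σ legal c₀ isolated₀ i t all-informed =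
    not-¬ (proj₁ (isolated-forever σ legal c₀ isolated₀ t i)) (all-informed (suc i))

2+k≤δ : ∀ {k δ} → 1 ≤ k → k ≤ δ ∸ 2 → suc (suc k) ≤ δ
2+k≤δ {δ = suc (suc δ)} _ k≤δ = s≤s (s≤s k≤δ)
2+k≤δ {δ = zero}        (s≤s _) ()
2+k≤δ {δ = suc zero}    (s≤s _) ()

theorem12 : (G : Graph) → ThreeVertexConnected G →
            (δ : ℕ) → IsMinDegree G δ →
            (k : ℕ) → 1 ≤ k → k ≤ δ ∸ 2 →
            ¬ BroadcastSolvable G k
theorem12 G 3conn δ (δ≤degree , v₀ , _) k 1≤k k≤δ∸2 (σ , legal , solves) =
  let t , all-informed = solves place place-injective trapAdversary
  in never-all-informed σ legal (initialConfig G k place) initially-isolated (fromℕ< 1≤k)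
       t all-informed
  where
  large-degree : ∀ u → suc (suc k) ≤ degree G u
  large-degree u = ≤-trans (2+k≤δ 1≤k k≤δ∸2) (δ≤degree u)

  open TrapAdversary G 3conn k large-degree

  agents≤n : suc k ≤ n G
  agents≤n = ≤-trans (n≤1+n _) (≤-trans (large-degree v₀) (degree≤n G v₀))

  place : Agent k → Vertex G
  place a = inject≤ a agents≤n

  place-injective : ∀ a b → place a ≡ place b → a ≡ b
  place-injective = inject≤-injective agents≤n agents≤n

  initially-isolated : SourceIsolated (initialConfig G k place)
  initially-isolated i = refl , 0≢1+n ∘ sym ∘ place-injective (suc i) zero
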